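{- Let $(C_n)_{n\ge 0}$ be defined by $C_0=0$, $C_1=1$ and $C_n=\sum_{i=1}^{n-1}C_iC_{n-i}$ for $n\ge 2$. Let $(f_n)_{n\ge 1}$ be defined by $f_1=1$ and \[ f_n=\sum_{i=1}^{n-1}\bigl(2^iC_i-f_i\bigr)f_{n-i}\qquad(n\ge 2). \] Then for every $n\ge 1$, $f_n\equiv C_n\pmod 2$; that is, $f_n$ is odd if and only if $C_n$ is odd, which happens if and only if $n$ is a power of $2$ (including $n=1$).
   Context: Combinatorially, $f_n$ is the number of rows with value "false" in the truth tables of all bracketings of the implication $p_1\to p_2\to\cdots\to p_n$ with $n$ distinct propositional variables; it satisfies the stated recurrence, which may be taken as its definition here. -}

module Defs where

open import Data.Nat using (ℕ; zero; suc; _∸_; _^_; _<?_)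
open import Data.Integer using (ℤ; +_; _+_; _*_; _-_)
open import Data.Product using (_×_; _,_; proj₁; proj₂; ∃)
import Data.Vec
open import Data.Vec using (Vec; []; _∷_; _∷ʳ_; lookup)
open import Data.Fin using (fromℕ; fromℕ<)
open import Relation.Nullary using (yes; no)
open import Relation.Binary.PropositionalEquality using (_≡_; refl)

sumFrom : (ℕ → ℤ) → ℕ → ℕ → ℤ
sumFrom g a zero    = + 0
sumFrom g a (suc k) = g a + sumFrom g (suc a) k

Σ₁ : ℕ → (ℕ → ℤ) → ℤ
Σ₁ n g = sumFrom g 1 (n ∸ 1)

-- Read index j of a table of length n (0 outside, never used).
at : ∀ {n} → Vec (ℤ × ℤ) n → ℕ → ℤ × ℤ
at {n} v j with j <? n
... | yes p = lookup v (fromℕ< p)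
... | no _  = (+ 0 , + 0)

step : ∀ n → Vec (ℤ × ℤ) n → ℤ × ℤ
step n v =
  Σ₁ n (λ i → proj₁ (at v i) * proj₁ (at v (n ∸ i))) ,
  Σ₁ n (λ i → ((+ (2 ^ i)) * proj₁ (at v i) - proj₂ (at v i)) * proj₂ (at v (n ∸ i)))

-- tab n holds (C_j , f_j) at position j, for j = 0, …, n.
-- C_0 = 0, C_1 = 1, f_1 = 1; f_0 is a dummy 0 (the paper's f starts at index 1
-- and f_0 never enters the recurrence, since the sum runs over 1 ≤ i ≤ n-1).
tab : (n : ℕ) → Vec (ℤ × ℤ) (suc n)
tab zero          = (+ 0 , + 0) ∷ []
tab (suc zero)    = (+ 0 , + 0) ∷ (+ 1 , + 1) ∷ []
tab (suc (suc m)) = tab (suc m) ∷ʳ step (suc (suc m)) (tab (suc m))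

C : ℕ → ℤ
C n = proj₁ (lookup (tab n) (fromℕ n))

f : ℕ → ℤ
f n = proj₂ (lookup (tab n) (fromℕ n))

IsPowerOf2 : ℕ → Set
IsPowerOf2 n = ∃ λ k → n ≡ 2 ^ k

private
  test₁ : Data.Vec.map C (0 ∷ 1 ∷ 2 ∷ 3 ∷ 4 ∷ 5 ∷ []) ≡ (+ 0 ∷ + 1 ∷ + 1 ∷ + 2 ∷ + 5 ∷ + 14 ∷ [])
  test₁ = refl
  test₂ : Data.Vec.map f (1 ∷ 2 ∷ 3 ∷ 4 ∷ []) ≡ (+ 1 ∷ + 1 ∷ + 4 ∷ + 19 ∷ [])
  test₂ = refl

-- Reducing the recurrence of f modulo 2,
-- the factor 2^i C_i − f_i becomes f_i (2^i is even for i ≥ 1), so by strong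
-- induction f obeys the Catalan recurrence mod 2 and f n ≡₂ C n.
--
-- For C itself: the summand C_i C_{n−i} of C_n is symmetric under
-- i ↦ n − i, so in the sum over 1 ≤ i ≤ n−1 the terms cancel in equal pairs
-- mod 2.  Only the middle term survives when n is even, whence
--   C (2h) ≡₂ C h · C h   and   C (2h+1) ≡₂ 0   (h ≥ 1),
-- and strong induction along n ↦ n/2 shows C n is odd exactly when n is a
-- power of two.
module Submission where

open import Defs
open import Data.Nat using (ℕ; _≥_)
open import Data.Integer using (_%ℕ_)
open import Data.Product using (_×_)
open import Function.Bundles using (_⇔_; mk⇔)
open import Relation.Binary.PropositionalEquality using (_≡_)

module Mod2 where
  open import Data.Nat as ℕ using (s≤s)
  open import Data.Integer
  open import Data.Integer.Properties using (pos-*)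
  open import Data.Integer.DivMod using (a≡a%ℕn+[a/ℕn]*n; n%ℕd<d)
  open import Data.Integer.Tactic.RingSolver using (solve-∀)
  open import Algebra.Definitions using (Congruent₂)
  open import Relation.Binary.Bundles using (Setoid)
  import Relation.Binary.Reasoning.Setoid
  open import Relation.Binary.PropositionalEquality
  open import Relation.Nullary using (¬_)
  open import Data.Empty using (⊥-elim)

  infix 4 _≡₂_

  record _≡₂_ (x y : ℤ) : Set where
    constructor differ-by
    field
      quotient : ℤ
      equation : x ≡ y + quotient * + 2

  ≡⇒≡₂ : ∀ {x y} → x ≡ y → x ≡₂ y
  ≡⇒≡₂ {x} refl = differ-by (+ 0) (lemma x)
    where lemma : ∀ x → x ≡ x + + 0 * + 2
          lemma = solve-∀

  ≡₂-refl : ∀ {x} → x ≡₂ x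
  ≡₂-refl = ≡⇒≡₂ refl

  ≡₂-sym : ∀ {x y} → x ≡₂ y → y ≡₂ x
  ≡₂-sym {y = y} (differ-by k refl) = differ-by (- k) (lemma y k)
    where lemma : ∀ y k → y ≡ y + k * + 2 + (- k) * + 2
          lemma = solve-∀

  ≡₂-trans : ∀ {x y z} → x ≡₂ y → y ≡₂ z → x ≡₂ z
  ≡₂-trans {z = z} (differ-by k refl) (differ-by l refl) = differ-by (l + k) (lemma z l k)
    where lemma : ∀ z l k → z + l * + 2 + k * + 2 ≡ z + (l + k) * + 2
          lemma = solve-∀

  ≡₂-setoid : Setoid _ _
  ≡₂-setoid = record
    { Carrier       = ℤ
    ; _≈_           = _≡₂_
    ; isEquivalence = record { refl = ≡₂-refl ; sym = ≡₂-sym ; trans = ≡₂-trans }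
    }

  module ≡₂-Reasoning = Relation.Binary.Reasoning.Setoid ≡₂-setoid

  +-cong : Congruent₂ _≡₂_ _+_
  +-cong {y = y} {v = v} (differ-by k refl) (differ-by l refl) = differ-by (k + l) (lemma y v k l)
    where lemma : ∀ y v k l → y + k * + 2 + (v + l * + 2) ≡ y + v + (k + l) * + 2
          lemma = solve-∀

  *-cong : Congruent₂ _≡₂_ _*_
  *-cong {y = y} {v = v} (differ-by k refl) (differ-by l refl) =
    differ-by (k * v + y * l + k * l * + 2) (lemma y v k l)
    where lemma : ∀ y v k l → (y + k * + 2) * (v + l * + 2) ≡ y * v + (k * v + y * l + k * l * + 2) * + 2
          lemma = solve-∀

  -- A summand occurring twice vanishes mod 2; this is how symmetric pairs cancel.
  pair-vanishes : ∀ x y → x + (y + x) ≡₂ y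
  pair-vanishes x y = differ-by x (lemma x y)
    where lemma : ∀ x y → x + (y + x) ≡ y + x * + 2
          lemma = solve-∀

  -- The factor 2^i C_i − f_i of the f-recurrence is f_i mod 2 when i ≥ 1.
  even-multiple-minus : ∀ k x y → + (2 ℕ.^ ℕ.suc k) * x - y ≡₂ y
  even-multiple-minus k x y =
    differ-by (+ (2 ℕ.^ k) * x - y) (trans (cong (λ t → t * x - y) (pos-* 2 (2 ℕ.^ k))) (lemma (+ (2 ℕ.^ k)) x y))
    where lemma : ∀ a x y → + 2 * a * x - y ≡ y + (a * x - y) * + 2
          lemma = solve-∀

  odd≢0 : ∀ k → ¬ (+ 0 ≡ + 1 + k * + 2)
  odd≢0 (+ 0)    ()
  odd≢0 +[1+ k ] ()
  odd≢0 -[1+ k ] ()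

  residues-distinct : ∀ {r s} → r ℕ.< 2 → s ℕ.< 2 → + r ≡₂ + s → r ≡ s
  residues-distinct {0} {0} _ _ _ = refl
  residues-distinct {1} {1} _ _ _ = refl
  residues-distinct {0} {1} _ _ (differ-by k e) = ⊥-elim (odd≢0 k e)
  residues-distinct {1} {0} r<2 s<2 c = sym (residues-distinct s<2 r<2 (≡₂-sym c))
  residues-distinct {ℕ.suc (ℕ.suc _)} (s≤s (s≤s ())) _ _
  residues-distinct {_} {ℕ.suc (ℕ.suc _)} _ (s≤s (s≤s ())) _

  ≡₂-remainder : ∀ x → x ≡₂ + (x %ℕ 2)
  ≡₂-remainder x = differ-by (x /ℕ 2) (a≡a%ℕn+[a/ℕn]*n x 2)

  ≡₂⇒%2 : ∀ {x y} → x ≡₂ y → x %ℕ 2 ≡ y %ℕ 2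
  ≡₂⇒%2 {x} {y} c = residues-distinct (n%ℕd<d x 2) (n%ℕd<d y 2)
    (≡₂-trans (≡₂-sym (≡₂-remainder x)) (≡₂-trans c (≡₂-remainder y)))

module Sums where
  open import Data.Nat using (zero; suc; _+_; _≤_; _<_; s≤s; z≤n)
  open import Data.Nat.Properties using (+-identityʳ; +-suc; ≤-refl; <⇒≤; m<m+n)
  open import Data.Integer as ℤ using (ℤ)
  import Data.Integer.Properties as ℤ
  open import Algebra.Definitions using (Congruent₂)
  open import Relation.Binary.Core using (Rel)
  open import Relation.Binary.Definitions using (Reflexive)
  open import Relation.Binary.PropositionalEquality

  -- Sums are congruent whenever their summands are, for any reflexive
  -- relation compatible with addition (used for both ≡ and ≡₂).
  sumFrom-cong : ∀ {ℓ} (_≈_ : Rel ℤ ℓ) → Reflexive _≈_ → Congruent₂ _≈_ ℤ._+_ →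
                 ∀ {g h} a k → (∀ i → a ≤ i → i < a + k → g i ≈ h i) →
                 sumFrom g a k ≈ sumFrom h a k
  sumFrom-cong _≈_ ≈-refl ≈-+ a zero    _  = ≈-refl
  sumFrom-cong _≈_ ≈-refl ≈-+ a (suc k) gh =
    ≈-+ (gh a ≤-refl (m<m+n a (s≤s z≤n)))
        (sumFrom-cong _≈_ ≈-refl ≈-+ (suc a) k λ i a<i i<a+1+k →
           gh i (<⇒≤ a<i) (subst (i <_) (sym (+-suc a k)) i<a+1+k))

  sumFrom-snoc : ∀ g a k → sumFrom g a (suc k) ≡ sumFrom g a k ℤ.+ g (a + k)
  sumFrom-snoc g a zero    = begin
    g a ℤ.+ ℤ.+ 0   ≡⟨ ℤ.+-identityʳ (g a) ⟩
    g a             ≡⟨ cong g (sym (+-identityʳ a)) ⟩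
    g (a + 0)       ≡⟨ sym (ℤ.+-identityˡ (g (a + 0))) ⟩
    ℤ.+ 0 ℤ.+ g (a + 0) ∎
    where open ≡-Reasoning
  sumFrom-snoc g a (suc k) = begin
    g a ℤ.+ sumFrom g (suc a) (suc k)                 ≡⟨ cong (λ t → g a ℤ.+ t) (sumFrom-snoc g (suc a) k) ⟩
    g a ℤ.+ (sumFrom g (suc a) k ℤ.+ g (suc a + k))  ≡⟨ sym (ℤ.+-assoc (g a) _ _) ⟩
    sumFrom g a (suc k) ℤ.+ g (suc a + k)            ≡⟨ cong (λ j → sumFrom g a (suc k) ℤ.+ g j) (sym (+-suc a k)) ⟩
    sumFrom g a (suc k) ℤ.+ g (a + suc k)            ∎
    where open ≡-Reasoning

module Recurrences where
  open import Data.Nat using (zero; suc; _+_; _∸_; _^_; _≤_; _<_; s≤s; z≤n; _<?_)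
  open import Data.Nat.Properties using (m≤n⇒m<n∨m≡n; m≤n⇒m≤1+n; n<1+n; ≤-pred; ∸-monoʳ-<)
  open import Data.Integer as ℤ using (ℤ; +_)
  open import Data.Fin using (fromℕ; fromℕ<)
  open import Data.Fin.Properties using (fromℕ-def)
  open import Data.Vec using (Vec; []; _∷_; _∷ʳ_; lookup)
  open import Data.Product using (proj₁; proj₂)
  open import Data.Sum using (inj₁; inj₂)
  open import Relation.Nullary using (yes; no; contradiction)
  open import Relation.Binary.PropositionalEquality
  open Sums using (sumFrom-cong)

  entry : ℕ → ℤ × ℤ
  entry j = lookup (tab j) (fromℕ j)

  at-lookup : ∀ {n} (v : Vec (ℤ × ℤ) n) {j} (j<n : j < n) → at v j ≡ lookup v (fromℕ< j<n)
  at-lookup {n} v {j} j<n with j <? n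
  ... | yes _   = refl
  ... | no  j≮n = contradiction j<n j≮n

  lookup-∷ʳ : ∀ {A : Set} {n j} (v : Vec A n) x (j<1+n : j < suc n) (j<n : j < n) →
              lookup (v ∷ʳ x) (fromℕ< j<1+n) ≡ lookup v (fromℕ< j<n)
  lookup-∷ʳ {j = zero}  (y ∷ v) x _           _         = refl
  lookup-∷ʳ {j = suc j} (y ∷ v) x (s≤s j<1+n) (s≤s j<n) = lookup-∷ʳ v x j<1+n j<n

  lookup-∷ʳ-last : ∀ {A : Set} {n} (v : Vec A n) x → lookup (v ∷ʳ x) (fromℕ n) ≡ x
  lookup-∷ʳ-last []      x = refl
  lookup-∷ʳ-last (y ∷ v) x = lookup-∷ʳ-last v x

  tab-extends : ∀ n {j} → j ≤ n → at (tab (suc n)) j ≡ at (tab n) j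
  tab-extends zero    z≤n  = refl
  tab-extends (suc m) {j} j≤1+m = begin
    at (tab (suc (suc m))) j                     ≡⟨ at-lookup (tab (suc (suc m))) j<3+m ⟩
    lookup (tab (suc (suc m))) (fromℕ< j<3+m)  ≡⟨ lookup-∷ʳ (tab (suc m)) _ j<3+m j<2+m ⟩
    lookup (tab (suc m)) (fromℕ< j<2+m)         ≡⟨ sym (at-lookup (tab (suc m)) j<2+m) ⟩
    at (tab (suc m)) j                           ∎
    where open ≡-Reasoning
          j<2+m : j < suc (suc m)
          j<2+m = s≤s j≤1+m
          j<3+m : j < suc (suc (suc m))
          j<3+m = s≤s (m≤n⇒m≤1+n j≤1+m)

  at-tab : ∀ n {j} → j ≤ n → at (tab n) j ≡ entry j
  at-tab n {j} j≤n with m≤n⇒m<n∨m≡n j≤n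
  ... | inj₂ refl = trans (at-lookup (tab n) (n<1+n n)) (cong (lookup (tab n)) (sym (fromℕ-def n)))
  at-tab (suc n) {j} _ | inj₁ (s≤s j≤n) = trans (tab-extends n j≤n) (at-tab n j≤n)

  entry-step : ∀ m → entry (2 + m) ≡ step (2 + m) (tab (1 + m))
  entry-step m = lookup-∷ʳ-last (tab (1 + m)) _

  -- Inside `step (2 + m)` every table read is a genuine entry, because both
  -- indices i and 2 + m − i lie in 1 … 1 + m.
  Σ₁-over-table : ∀ m (φ : ℕ → ℤ × ℤ → ℤ × ℤ → ℤ) →
    Σ₁ (2 + m) (λ i → φ i (at (tab (1 + m)) i) (at (tab (1 + m)) (2 + m ∸ i))) ≡
    Σ₁ (2 + m) (λ i → φ i (entry i) (entry (2 + m ∸ i)))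
  Σ₁-over-table m φ = sumFrom-cong _≡_ refl (cong₂ ℤ._+_) 1 (1 + m) reads-entries
    where
    reads-entries : ∀ i → 1 ≤ i → i < 2 + m →
      φ i (at (tab (1 + m)) i) (at (tab (1 + m)) (2 + m ∸ i)) ≡ φ i (entry i) (entry (2 + m ∸ i))
    reads-entries i 1≤i (s≤s i≤1+m) =
      cong₂ (φ i) (at-tab (1 + m) i≤1+m) (at-tab (1 + m) (≤-pred (∸-monoʳ-< 1≤i (m≤n⇒m≤1+n i≤1+m))))

  C-rec : ∀ m → C (2 + m) ≡ Σ₁ (2 + m) (λ i → C i ℤ.* C (2 + m ∸ i))
  C-rec m = trans (cong proj₁ (entry-step m)) (Σ₁-over-table m (λ _ a b → proj₁ a ℤ.* proj₁ b))

  f-rec : ∀ m → f (2 + m) ≡ Σ₁ (2 + m) (λ i → (+ (2 ^ i) ℤ.* C i ℤ.- f i) ℤ.* f (2 + m ∸ i))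
  f-rec m = trans (cong proj₂ (entry-step m))
    (Σ₁-over-table m (λ i a b → (+ (2 ^ i) ℤ.* proj₁ a ℤ.- proj₂ a) ℤ.* proj₂ b))

module Doubling where
  open import Data.Nat using (zero; suc; _+_; _^_; ⌊_/2⌋)
  open import Data.Nat.Properties using (+-suc; +-identityʳ; suc-injective; n≡⌊n+n/2⌋)
  open import Data.Product using (_,_)
  open import Relation.Nullary using (¬_; contradiction)
  open import Relation.Binary.PropositionalEquality

  double-suc : ∀ j → suc j + suc j ≡ suc (suc (j + j))
  double-suc j = cong suc (+-suc j j)

  double-injective : ∀ {h m} → h + h ≡ m + m → h ≡ m
  double-injective {h} {m} e = trans (n≡⌊n+n/2⌋ h) (trans (cong ⌊_/2⌋ e) (sym (n≡⌊n+n/2⌋ m)))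

  odd≢even : ∀ h m → suc (h + h) ≢ m + m
  odd≢even h       zero    ()
  odd≢even zero    (suc m) e with trans e (double-suc m)
  ... | ()
  odd≢even (suc h) (suc m) e =
    odd≢even h m (suc-injective (suc-injective (trans (sym (cong suc (double-suc h))) (trans e (double-suc m)))))

  data Halving : ℕ → Set where
    even : ∀ h → Halving (h + h)
    odd  : ∀ h → Halving (suc (h + h))

  halving : ∀ n → Halving n
  halving zero = even 0
  halving (suc n) with halving n
  ... | even h = odd h
  ... | odd  h = subst Halving (double-suc h) (even (suc h))

  pow2-double : ∀ k → 2 ^ suc k ≡ 2 ^ k + 2 ^ k
  pow2-double k = cong (2 ^ k +_) (+-identityʳ (2 ^ k))

  double-pow2 : ∀ {h} → IsPowerOf2 h → IsPowerOf2 (h + h)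
  double-pow2 (k , refl) = suc k , sym (pow2-double k)

  half-pow2 : ∀ {h} → IsPowerOf2 (h + h) → IsPowerOf2 h
  half-pow2 {h} (zero  , e) = contradiction (sym e) (odd≢even 0 h)
  half-pow2 {h} (suc k , e) = k , double-injective (trans e (pow2-double k))

  odd-not-pow2 : ∀ j → ¬ IsPowerOf2 (suc (suc j + suc j))
  odd-not-pow2 j (zero  , ())
  odd-not-pow2 j (suc k , e) = odd≢even (suc j) (2 ^ k) (trans e (pow2-double k))

-- Sums whose summands are symmetric about M/2: the terms i and M − i agree,
-- so mod 2 they cancel in pairs, leaving the middle term (if any).
module SymmetricSums where
  open import Data.Nat using (zero; suc; _+_)
  open import Data.Nat.Properties using (+-suc; +-identityʳ; suc-injective)
  open import Data.Nat.Tactic.RingSolver using (solve-∀)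
  open import Data.Integer as ℤ using (ℤ; +_)
  import Data.Integer.Properties as ℤ
  open import Relation.Binary.PropositionalEquality
  open Mod2
  open Sums using (sumFrom-snoc)
  open Doubling using (double-suc)
  open ≡₂-Reasoning

  module Pairing (g : ℕ → ℤ) (M : ℕ) (mirror : ∀ a b → a + b ≡ M → g b ≡ g a) where

    -- The hypotheses on a and j say the summation range a … a + len − 1 has
    -- endpoints adding up to M; peeling off both endpoints (a pair equal by
    -- `mirror`) keeps this invariant for a + 1 and len − 2.

    odd-length : ∀ j a → a + a + (j + j) ≡ M → sumFrom g a (suc (j + j)) ≡₂ g (a + j)
    odd-length zero    a _ = ≡⇒≡₂ (trans (ℤ.+-identityʳ (g a)) (cong g (sym (+-identityʳ a))))
    odd-length (suc j) a h = begin
      sumFrom g a (suc (suc j + suc j))              ≡⟨ cong (λ l → sumFrom g a (suc l)) (double-suc j) ⟩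
      g a ℤ.+ sumFrom g (suc a) (suc (suc (j + j)))  ≡⟨ cong (λ t → g a ℤ.+ t) (sumFrom-snoc g (suc a) (suc (j + j))) ⟩
      g a ℤ.+ (S ℤ.+ g (suc a + suc (j + j)))        ≡⟨ cong (λ t → g a ℤ.+ (S ℤ.+ t)) (mirror a _ (trans (endpoints a j) h)) ⟩
      g a ℤ.+ (S ℤ.+ g a)                            ≈⟨ pair-vanishes (g a) S ⟩
      S                                              ≈⟨ odd-length j (suc a) (trans (inner a j) h) ⟩
      g (suc a + j)                                  ≡⟨ cong g (sym (+-suc a j)) ⟩
      g (a + suc j)                                  ∎
      where
      S = sumFrom g (suc a) (suc (j + j))
      endpoints : ∀ a j → a + (suc a + suc (j + j)) ≡ a + a + (suc j + suc j)
      endpoints = solve-∀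
      inner : ∀ a j → suc a + suc a + (j + j) ≡ a + a + (suc j + suc j)
      inner = solve-∀

    even-length : ∀ j a → a + a + (j + j) ≡ suc M → sumFrom g a (j + j) ≡₂ + 0
    even-length zero    a _ = ≡₂-refl
    even-length (suc j) a h = begin
      sumFrom g a (suc j + suc j)              ≡⟨ cong (sumFrom g a) (double-suc j) ⟩
      g a ℤ.+ sumFrom g (suc a) (suc (j + j))  ≡⟨ cong (λ t → g a ℤ.+ t) (sumFrom-snoc g (suc a) (j + j)) ⟩
      g a ℤ.+ (S ℤ.+ g (suc a + (j + j)))      ≡⟨ cong (λ t → g a ℤ.+ (S ℤ.+ t)) (mirror a _ (suc-injective (trans (endpoints a j) h))) ⟩
      g a ℤ.+ (S ℤ.+ g a)                      ≈⟨ pair-vanishes (g a) S ⟩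
      S                                        ≈⟨ even-length j (suc a) (trans (inner a j) h) ⟩
      + 0                                      ∎
      where
      S = sumFrom g (suc a) (j + j)
      endpoints : ∀ a j → suc (a + (suc a + (j + j))) ≡ a + a + (suc j + suc j)
      endpoints = solve-∀
      inner : ∀ a j → suc a + suc a + (j + j) ≡ a + a + (suc j + suc j)
      inner = solve-∀

module CatalanParity where
  open import Data.Nat using (zero; suc; _+_; _∸_; _≤_; _<_; s≤s; z≤n)
  open import Data.Nat.Properties using (+-comm; m+n∸m≡n; m<m+n)
  open import Data.Nat.Induction using (<-rec)
  open import Data.Integer as ℤ using (ℤ; +_)
  import Data.Integer.Properties as ℤ
  open import Data.Product using (_,_)
  open import Data.Sum using (_⊎_; inj₁; inj₂)
  open import Function using (_∘_)
  open import Relation.Nullary using (¬_)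
  open import Relation.Binary.PropositionalEquality
  open Mod2
  open Doubling
  open Recurrences using (C-rec)

  ∸-complement : ∀ a b {M} → a + b ≡ M → M ∸ a ≡ b
  ∸-complement a b refl = m+n∸m≡n a b

  catalan-term : ℕ → ℕ → ℤ
  catalan-term M i = C i ℤ.* C (M ∸ i)

  catalan-term-mirror : ∀ M a b → a + b ≡ M → catalan-term M b ≡ catalan-term M a
  catalan-term-mirror M a b e = begin
    C b ℤ.* C (M ∸ b)  ≡⟨ cong (λ t → C b ℤ.* C t) (∸-complement b a (trans (+-comm b a) e)) ⟩
    C b ℤ.* C a        ≡⟨ ℤ.*-comm (C b) (C a) ⟩
    C a ℤ.* C b        ≡⟨ cong (λ t → C a ℤ.* C t) (sym (∸-complement a b e)) ⟩
    C a ℤ.* C (M ∸ a)  ∎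
    where open ≡-Reasoning

  C-double : ∀ j → C (suc j + suc j) ≡₂ C (suc j) ℤ.* C (suc j)
  C-double j = begin
    C (suc j + suc j)                     ≡⟨ cong C (double-suc j) ⟩
    C (2 + (j + j))                       ≡⟨ C-rec (j + j) ⟩
    sumFrom (catalan-term M) 1 (suc (j + j))  ≈⟨ odd-length j 1 refl ⟩
    catalan-term M (suc j)                ≡⟨ cong (λ t → C (suc j) ℤ.* C t) (∸-complement (suc j) (suc j) (double-suc j)) ⟩
    C (suc j) ℤ.* C (suc j)               ∎
    where
    M = 2 + (j + j)
    open SymmetricSums.Pairing (catalan-term M) M (catalan-term-mirror M)
    open ≡₂-Reasoning

  C-odd : ∀ j → C (suc (suc j + suc j)) ≡₂ + 0
  C-odd j = begin
    C (suc (suc j + suc j))                        ≡⟨ cong (C ∘ suc) (double-suc j) ⟩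
    C (2 + suc (j + j))                            ≡⟨ C-rec (suc (j + j)) ⟩
    sumFrom (catalan-term M) 1 (suc (suc (j + j)))  ≡⟨ cong (sumFrom (catalan-term M) 1) (sym (double-suc j)) ⟩
    sumFrom (catalan-term M) 1 (suc j + suc j)     ≈⟨ even-length (suc j) 1 (cong (λ l → 2 + l) (double-suc j)) ⟩
    + 0                                            ∎
    where
    M = 2 + suc (j + j)
    open SymmetricSums.Pairing (catalan-term M) M (catalan-term-mirror M)
    open ≡₂-Reasoning

  Parity : ℕ → Set
  Parity n = (IsPowerOf2 n × C n ≡₂ + 1) ⊎ (¬ IsPowerOf2 n × C n ≡₂ + 0)

  parity-double : ∀ j → Parity (suc j) → Parity (suc j + suc j)
  parity-double j (inj₁ (pow2 , odd-C))      = inj₁ (double-pow2 pow2 , ≡₂-trans (C-double j) (*-cong odd-C odd-C))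
  parity-double j (inj₂ (not-pow2 , even-C)) = inj₂ (not-pow2 ∘ half-pow2 , ≡₂-trans (C-double j) (*-cong even-C even-C))

  catalan-parity : ∀ n → 1 ≤ n → Parity n
  catalan-parity = <-rec (λ n → 1 ≤ n → Parity n) by-halving
    where
    by-halving : ∀ n → (∀ {m} → m < n → 1 ≤ m → Parity m) → 1 ≤ n → Parity n
    by-halving n rec 1≤n with halving n
    by-halving _ rec () | even zero
    ... | even (suc j) = parity-double j (rec (m<m+n (suc j) (s≤s z≤n)) (s≤s z≤n))
    ... | odd zero     = inj₁ ((0 , refl) , ≡₂-refl)
    ... | odd (suc j)  = inj₂ (odd-not-pow2 j , C-odd j)

module FParity where
  open import Data.Nat using (suc; _∸_; _^_; _≤_; _<_)
  open import Data.Nat.Properties using (∸-monoʳ-<; <⇒≤; m<n⇒0<n∸m)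
  open import Data.Nat.Induction using (<-rec)
  open import Data.Integer as ℤ using (+_)
  open import Relation.Binary.PropositionalEquality
  open Mod2
  open Sums using (sumFrom-cong)
  open Recurrences using (C-rec; f-rec)
  open CatalanParity using (catalan-term)

  f≡₂C : ∀ n → 1 ≤ n → f n ≡₂ C n
  f≡₂C = <-rec (λ n → 1 ≤ n → f n ≡₂ C n) by-recurrence
    where
    by-recurrence : ∀ n → (∀ {m} → m < n → 1 ≤ m → f m ≡₂ C m) → 1 ≤ n → f n ≡₂ C n
    by-recurrence 1 _ _ = ≡₂-refl
    by-recurrence n@(suc (suc m)) rec _ = begin
      f n                                                   ≡⟨ f-rec m ⟩
      Σ₁ n (λ i → (+ (2 ^ i) ℤ.* C i ℤ.- f i) ℤ.* f (n ∸ i))  ≈⟨ sumFrom-cong _≡₂_ ≡₂-refl +-cong 1 (suc m) summands ⟩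
      Σ₁ n (catalan-term n)                                 ≡⟨ C-rec m ⟨
      C n                                                   ∎
      where
      open ≡₂-Reasoning
      summands : ∀ i → 1 ≤ i → i < n → (+ (2 ^ i) ℤ.* C i ℤ.- f i) ℤ.* f (n ∸ i) ≡₂ catalan-term n i
      summands i@(suc k) 1≤i i<n = *-cong
        (≡₂-trans (even-multiple-minus k (C i) (f i)) (rec i<n 1≤i))
        (rec (∸-monoʳ-< 1≤i (<⇒≤ i<n)) (m<n⇒0<n∸m i<n))

open import Data.Product using (_,_)
open import Data.Sum using (inj₁; inj₂)
open import Relation.Nullary using (contradiction)
open import Relation.Binary.PropositionalEquality using (sym; trans)
open Mod2 using (≡₂⇒%2)
open CatalanParity using (catalan-parity)
open FParity using (f≡₂C)

catalan-odd⇔pow2 : ∀ n → n ≥ 1 → (C n %ℕ 2 ≡ 1) ⇔ IsPowerOf2 n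
catalan-odd⇔pow2 n 1≤n with catalan-parity n 1≤n
... | inj₁ (pow2 , odd-C)      = mk⇔ (λ _ → pow2) (λ _ → ≡₂⇒%2 odd-C)
... | inj₂ (not-pow2 , even-C) =
  mk⇔ (λ odd → contradiction (trans (sym (≡₂⇒%2 even-C)) odd) λ ())
      (λ pow2 → contradiction pow2 not-pow2)

theorem2p5 : ∀ (n : ℕ) → n ≥ 1 →
    (f n %ℕ 2 ≡ C n %ℕ 2) × ((C n %ℕ 2 ≡ 1) ⇔ IsPowerOf2 n)
theorem2p5 n 1≤n = ≡₂⇒%2 (f≡₂C n 1≤n) , catalan-odd⇔pow2 n 1≤n
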